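{- For all integers $a,b\geq 1$ there exists a shiftable $SMR(4b+1,2a(4b+1);4a,2)$.
   Context: A signed magic rectangle $SMR(m,n;r,s)$ is an $m\times n$ array, some of whose cells are filled with integers and the others empty, such that exactly $r$ cells in every row and exactly $s$ cells in every column are filled (so $mr=ns$), every element of $X$ appears exactly once in the array, and the sum of the entries of each row and of each column is zero, where (for $mr$ even) $X=\{\pm1,\pm2,\ldots,\pm mr/2\}$. An array is shiftable if every row and every column contains the same number of positive entries as negative entries. -}

module Defs where

open import Data.Nat using (ℕ; zero; suc; _*_; _≤_)
open import Data.Nat.DivMod using (_/_)
open import Data.Integer as ℤ using (ℤ; +_; ∣_∣)
open import Data.Fin using (Fin)
open import Data.Bool using (Bool; true; false)
open import Data.Maybe using (Maybe; just; nothing)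
open import Data.Product using (_×_; Σ; ∃; _,_)
open import Relation.Binary.PropositionalEquality using (_≡_; _≢_)

countFin : ∀ {n} → (Fin n → Bool) → ℕ
countFin {zero}  p = 0
countFin {suc n} p with p Fin.zero
... | true  = suc (countFin {n} (λ i → p (Fin.suc i)))
... | false = countFin {n} (λ i → p (Fin.suc i))

sumFin : ∀ {n} → (Fin n → ℤ) → ℤ
sumFin {zero}  f = + 0
sumFin {suc n} f = f Fin.zero ℤ.+ sumFin {n} (λ i → f (Fin.suc i))

-- a partially filled m × n array of integers (nothing = empty cell)
Array : ℕ → ℕ → Set
Array m n = Fin m → Fin n → Maybe ℤ

isFilled : Maybe ℤ → Bool
isFilled (just _) = true
isFilled nothing  = false

isPos : Maybe ℤ → Bool
isPos (just (+ suc _)) = true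
isPos _                = false

isNeg : Maybe ℤ → Bool
isNeg (just ℤ.-[1+ _ ]) = true
isNeg _                 = false

val : Maybe ℤ → ℤ
val (just x) = x
val nothing  = + 0

InX : ℕ → ℤ → Set
InX k x = (x ≢ + 0) × (∣ x ∣ ≤ k)

-- signed magic rectangle SMR(m,n;r,s), with X = {±1,…,±(m*r)/2}
-- (used only when m*r is even)
record IsSMR (m n r s : ℕ) (A : Array m n) : Set where
  field
    rowFilled : ∀ i → countFin (λ j → isFilled (A i j)) ≡ r
    colFilled : ∀ j → countFin (λ i → isFilled (A i j)) ≡ s
    entriesInX : ∀ i j x → A i j ≡ just x → InX ((m * r) / 2) x
    eachOnce : ∀ x → InX ((m * r) / 2) x →
      Σ (Fin m × Fin n) λ { (i , j) → (A i j ≡ just x) ×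
        (∀ i' j' → A i' j' ≡ just x → (i' ≡ i) × (j' ≡ j)) }
    rowSum : ∀ i → sumFin (λ j → val (A i j)) ≡ + 0
    colSum : ∀ j → sumFin (λ i → val (A i j)) ≡ + 0

Shiftable : ∀ {m n} → Array m n → Set
Shiftable {m} {n} A =
  (∀ i → countFin (λ j → isPos (A i j)) ≡ countFin (λ j → isNeg (A i j))) ×
  (∀ j → countFin (λ i → isPos (A i j)) ≡ countFin (λ i → isNeg (A i j)))

module Submission where

-- Split the 2a·m columns into 2a blocks of m consecutive columns. Column j receives +(j+1)
-- in one row and −(j+1) in another, so columns are balanced and every element of X occurs
-- exactly once. Inside a block, the rows of the positive and of the negative entries are given
-- by two permutations of the rows, the identity and a cyclic rotation ρ; hence every row meets
-- one positive and one negative entry per block, and as the block's values are consecutive,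
-- row i gains ±(i − ρ⁻¹ i) from it. Half of the blocks exchange the roles of the two
-- permutations, so all row sums vanish.

open import Defs
open import Algebra.Bundles using (Monoid; CommutativeMonoid)
import Algebra.Properties.CommutativeMonoid.Sum as CommutativeMonoidSum
open import Data.Bool using (Bool; true; false; if_then_else_)
open import Data.Fin as Fin
  using (Fin; zero; suc; toℕ; fromℕ<; combine; quotient; remainder; _↑ˡ_; _↑ʳ_)
open import Data.Fin.Patterns using (0F; 1F)
open import Data.Fin.Permutation
  using (Permutation′; _⟨$⟩ʳ_; _⟨$⟩ˡ_; inverseˡ; id; reverse; lift₀; _∘ₚ_)
open import Data.Fin.Properties
  using (_≟_; remQuot-combine; toℕ-combine; toℕ<n; toℕ-fromℕ<; toℕ-injective; toℕ-inject₁;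
         opposite-involutive)
open import Data.Integer as ℤ using (ℤ; +_; 0ℤ; +[1+_]; -[1+_]; _⊖_)
import Data.Integer.Properties as ℤₚ
open import Data.Maybe using (Maybe; just; nothing)
open import Data.Nat as ℕ using (ℕ; zero; suc; _+_; _*_; _≤_; _≥_; s≤s; z≤n)
open import Data.Nat.DivMod using (_/_; m*n/n≡m)
import Data.Nat.Properties as ℕₚ
open import Data.Nat.Tactic.RingSolver using (solve-∀)
open import Data.Product using (Σ; _×_; _,_; proj₁; proj₂)
open import Data.Sum using (_⊎_; inj₁; inj₂)
open import Function using (_∘_)
open import Relation.Nullary using (does; yes; no)
open import Relation.Nullary.Negation using (contradiction)
open import Relation.Binary.PropositionalEquality as ≡ using (_≡_; _≢_; refl; cong; cong₂; subst)

does-≟-sym : ∀ {n} (i j : Fin n) → does (i ≟ j) ≡ does (j ≟ i)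
does-≟-sym i j with i ≟ j | j ≟ i
... | yes _   | yes _   = refl
... | no _    | no _    = refl
... | yes i≡j | no j≢i  = contradiction (≡.sym i≡j) j≢i
... | no i≢j  | yes j≡i = contradiction (≡.sym j≡i) i≢j

blockwise : ∀ {k m} → (Fin k → Permutation′ m) → Fin (k * m) → Fin m
blockwise {k} {m} σ j = σ (quotient {k} m j) ⟨$⟩ʳ remainder {k} m j

blockwise-combine : ∀ {k m} (σ : Fin k → Permutation′ m) (x : Fin k) (y : Fin m) →
                    blockwise σ (combine x y) ≡ σ x ⟨$⟩ʳ y
blockwise-combine {k} {m} σ x y =
  cong (λ q → σ (proj₁ q) ⟨$⟩ʳ proj₂ q) (remQuot-combine {k} {m} x y)

module MonoidSum {c ℓ} (M : Monoid c ℓ) where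
  open Monoid M renaming (refl to ≈-refl)
  open import Algebra.Properties.Monoid.Sum M
  open import Relation.Binary.Reasoning.Setoid setoid

  sum-↑ : ∀ p q (f : Fin (p + q) → Carrier) →
          sum f ≈ sum (f ∘ (_↑ˡ q)) ∙ sum (f ∘ (p ↑ʳ_))
  sum-↑ zero    q f = sym (identityˡ _)
  sum-↑ (suc p) q f = begin
    f zero ∙ sum (f ∘ suc)                                     ≈⟨ ∙-congˡ (sum-↑ p q (f ∘ suc)) ⟩
    f zero ∙ (sum (f ∘ suc ∘ (_↑ˡ q)) ∙ sum (f ∘ (suc p ↑ʳ_))) ≈⟨ sym (assoc _ _ _) ⟩
    sum (f ∘ (_↑ˡ q)) ∙ sum (f ∘ (suc p ↑ʳ_))                  ∎

  sum-combine : ∀ k m (f : Fin (k * m) → Carrier) →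
                sum f ≈ ∑[ x < k ] ∑[ y < m ] f (combine x y)
  sum-combine zero    m f = ≈-refl
  sum-combine (suc k) m f = trans (sum-↑ m (k * m) f) (∙-congˡ (sum-combine k m (f ∘ (m ↑ʳ_))))

module IndicatorSum {c ℓ} (M : CommutativeMonoid c ℓ) where
  open CommutativeMonoid M renaming (refl to ≈-refl)
  open CommutativeMonoidSum M public
  open MonoidSum monoid public
  open import Relation.Binary.Reasoning.Setoid setoid

  sum-δ : ∀ {n} (i : Fin n) (f : Fin n → Carrier) →
          ∑[ z < n ] (if does (z ≟ i) then f z else ε) ≈ f i
  sum-δ {suc n} zero    f = trans (∙-congˡ (sum-replicate-zero n)) (identityʳ _)
  sum-δ {suc n} (suc i) f = trans (identityˡ _) (sum-δ i (f ∘ suc))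

  sum-δ′ : ∀ {n} (i : Fin n) (f : Fin n → Carrier) →
           ∑[ z < n ] (if does (i ≟ z) then f z else ε) ≈ f i
  sum-δ′ i f = trans
    (reflexive (sum-cong-≗ (λ z → cong (λ b → if b then f z else ε) (does-≟-sym i z))))
    (sum-δ i f)

  sum-δ-permute : ∀ {n} (π : Permutation′ n) (i : Fin n) (f : Fin n → Carrier) →
                  ∑[ y < n ] (if does (π ⟨$⟩ʳ y ≟ i) then f y else ε) ≈ f (π ⟨$⟩ˡ i)
  sum-δ-permute {n} π i f = begin
    ∑[ y < n ] (if does (π ⟨$⟩ʳ y ≟ i) then f y else ε)
      ≡⟨ sum-cong-≗ (λ y → cong (λ z → if does (π ⟨$⟩ʳ y ≟ i) then f z else ε) (≡.sym (inverseˡ π))) ⟩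
    ∑[ y < n ] g (π ⟨$⟩ʳ y) ≈⟨ sym (∑-permute g π) ⟩
    ∑[ z < n ] g z          ≈⟨ sum-δ i (f ∘ (π ⟨$⟩ˡ_)) ⟩
    f (π ⟨$⟩ˡ i)            ∎
    where
    g : Fin n → Carrier
    g z = if does (z ≟ i) then f (π ⟨$⟩ˡ z) else ε

  sum-δ-blockwise : ∀ {k m} (σ : Fin k → Permutation′ m) (i : Fin m) (f : Fin (k * m) → Carrier) →
                    ∑[ j < k * m ] (if does (blockwise σ j ≟ i) then f j else ε) ≈
                    ∑[ x < k ] f (combine x (σ x ⟨$⟩ˡ i))
  sum-δ-blockwise {k} {m} σ i f = begin
    ∑[ j < k * m ] (if does (blockwise σ j ≟ i) then f j else ε)
      ≈⟨ sum-combine k m _ ⟩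
    ∑[ x < k ] ∑[ y < m ] (if does (blockwise σ (combine x y) ≟ i) then f (combine x y) else ε)
      ≡⟨ sum-cong-≗ (λ x → sum-cong-≗ (λ y →
           cong (λ z → if does (z ≟ i) then f (combine x y) else ε) (blockwise-combine σ x y))) ⟩
    ∑[ x < k ] ∑[ y < m ] (if does (σ x ⟨$⟩ʳ y ≟ i) then f (combine x y) else ε)
      ≈⟨ sum-cong-≋ (λ x → sum-δ-permute (σ x) i (f ∘ combine x)) ⟩
    ∑[ x < k ] f (combine x (σ x ⟨$⟩ˡ i)) ∎

  sum-quotient : ∀ k a (g : Fin k → Carrier) →
                 ∑[ x < k * a ] g (quotient {k} a x) ≈ ∑[ _ < a ] sum g
  sum-quotient k a g = begin
    ∑[ x < k * a ] g (quotient {k} a x)                        ≈⟨ sum-combine k a _ ⟩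
    ∑[ h < k ] ∑[ y < a ] g (quotient {k} a (combine h y))
      ≡⟨ sum-cong-≗ (λ h → sum-cong-≗ (λ y → cong (g ∘ proj₁) (remQuot-combine {k} {a} h y))) ⟩
    ∑[ h < k ] ∑[ _ < a ] g h                                  ≈⟨ ∑-comm {k} {a} (λ h _ → g h) ⟩
    ∑[ _ < a ] sum g                                           ∎

module ℕΣ = IndicatorSum ℕₚ.+-0-commutativeMonoid
module ℤΣ = IndicatorSum ℤₚ.+-0-commutativeMonoid

open ≡.≡-Reasoning

-- The cyclic shift 0 ↦ n, i+1 ↦ i, as a composite of two reflections.
rotation : ∀ {n} → Permutation′ (suc n)
rotation = lift₀ reverse ∘ₚ reverse

rotation-≢ : ∀ {n} (y : Fin (suc (suc n))) → rotation ⟨$⟩ʳ y ≢ y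
rotation-≢ zero    ()
rotation-≢ (suc y) eq = ℕₚ.1+n≢n (begin
  suc (toℕ y)                         ≡⟨ cong toℕ eq ⟨
  toℕ (rotation ⟨$⟩ʳ suc y)           ≡⟨ toℕ-inject₁ _ ⟩
  toℕ (Fin.opposite (Fin.opposite y)) ≡⟨ cong toℕ (opposite-involutive y) ⟩
  toℕ y                               ∎)

indicator : Bool → ℕ
indicator b = if b then 1 else 0

countFin≡sum : ∀ {n} (p : Fin n → Bool) → countFin p ≡ ℕΣ.sum (indicator ∘ p)
countFin≡sum {zero}  p = refl
countFin≡sum {suc n} p with p zero
... | true  = cong suc (countFin≡sum (p ∘ suc))
... | false = countFin≡sum (p ∘ suc)

sumFin≡sum : ∀ {n} (f : Fin n → ℤ) → sumFin f ≡ ℤΣ.sum f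
sumFin≡sum {zero}  f = refl
sumFin≡sum {suc n} f = cong (λ s → f zero ℤ.+ s) (sumFin≡sum (f ∘ suc))

countFin-cong : ∀ {n} {p q : Fin n → Bool} → (∀ i → p i ≡ q i) → countFin p ≡ countFin q
countFin-cong {p = p} {q} p≗q = ≡.trans (countFin≡sum p)
  (≡.trans (ℕΣ.sum-cong-≗ (cong indicator ∘ p≗q)) (≡.sym (countFin≡sum q)))

countFin-≟ : ∀ {n} (r : Fin n) → countFin (λ i → does (r ≟ i)) ≡ 1
countFin-≟ r = ≡.trans (countFin≡sum (λ i → does (r ≟ i))) (ℕΣ.sum-δ′ r (λ _ → 1))

sum-ones : ∀ k → ℕΣ.sum {k} (λ _ → 1) ≡ k
sum-ones zero    = refl
sum-ones (suc k) = cong suc (sum-ones k)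

isFilled≡isPos+isNeg : ∀ (c : Maybe ℤ) → c ≢ just 0ℤ →
                       indicator (isFilled c) ≡ indicator (isPos c) + indicator (isNeg c)
isFilled≡isPos+isNeg nothing           _   = refl
isFilled≡isPos+isNeg (just (+ zero))   c≢0 = contradiction refl c≢0
isFilled≡isPos+isNeg (just +[1+ _ ])   _   = refl
isFilled≡isPos+isNeg (just -[1+ _ ])   _   = refl

countFin-isFilled : ∀ {n} (c : Fin n → Maybe ℤ) → (∀ j → c j ≢ just 0ℤ) →
                    countFin (isFilled ∘ c) ≡ countFin (isPos ∘ c) + countFin (isNeg ∘ c)
countFin-isFilled c c≢0 = begin
  countFin (isFilled ∘ c)
    ≡⟨ countFin≡sum (isFilled ∘ c) ⟩
  ℕΣ.sum (indicator ∘ isFilled ∘ c)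
    ≡⟨ ℕΣ.sum-cong-≗ (λ j → isFilled≡isPos+isNeg (c j) (c≢0 j)) ⟩
  ℕΣ.sum (λ j → indicator (isPos (c j)) + indicator (isNeg (c j)))
    ≡⟨ ℕΣ.∑-distrib-+ (indicator ∘ isPos ∘ c) (indicator ∘ isNeg ∘ c) ⟩
  ℕΣ.sum (indicator ∘ isPos ∘ c) + ℕΣ.sum (indicator ∘ isNeg ∘ c)
    ≡⟨ cong₂ _+_ (countFin≡sum (isPos ∘ c)) (countFin≡sum (isNeg ∘ c)) ⟨
  countFin (isPos ∘ c) + countFin (isNeg ∘ c)
    ∎


pairedColumns : ∀ {m n} (P Q : Fin n → Fin m) → Array m n
pairedColumns P Q i j =
  if does (P j ≟ i) then just +[1+ toℕ j ]
  else if does (Q j ≟ i) then just -[1+ toℕ j ]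
  else nothing

module PairedColumns {m n} (P Q : Fin n → Fin m) (P≢Q : ∀ j → P j ≢ Q j) where

  A : Array m n
  A = pairedColumns P Q

  A-just : ∀ {i j x} → A i j ≡ just x →
           (P j ≡ i × x ≡ +[1+ toℕ j ]) ⊎ (Q j ≡ i × x ≡ -[1+ toℕ j ])
  A-just {i} {j} eq with P j ≟ i | Q j ≟ i | eq
  ... | yes Pj≡i | _        | refl = inj₁ (Pj≡i , refl)
  ... | no _     | yes Qj≡i | refl = inj₂ (Qj≡i , refl)
  ... | no _     | no _     | ()

  A-P : ∀ j → A (P j) j ≡ just +[1+ toℕ j ]
  A-P j with P j ≟ P j
  ... | yes _    = refl
  ... | no Pj≢Pj = contradiction refl Pj≢Pj

  A-Q : ∀ j → A (Q j) j ≡ just -[1+ toℕ j ]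
  A-Q j with P j ≟ Q j | Q j ≟ Q j
  ... | yes Pj≡Qj | _        = contradiction Pj≡Qj (P≢Q j)
  ... | no _      | yes _    = refl
  ... | no _      | no Qj≢Qj = contradiction refl Qj≢Qj

  A≢0 : ∀ i j → A i j ≢ just 0ℤ
  A≢0 i j eq with A-just eq
  ... | inj₁ (_ , ())
  ... | inj₂ (_ , ())

  isPos-A : ∀ i j → isPos (A i j) ≡ does (P j ≟ i)
  isPos-A i j with P j ≟ i | Q j ≟ i
  ... | yes _ | _     = refl
  ... | no _  | yes _ = refl
  ... | no _  | no _  = refl

  isNeg-A : ∀ i j → isNeg (A i j) ≡ does (Q j ≟ i)
  isNeg-A i j with P j ≟ i | Q j ≟ i
  ... | yes Pj≡i | yes Qj≡i = contradiction (≡.trans Pj≡i (≡.sym Qj≡i)) (P≢Q j)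
  ... | yes _    | no _     = refl
  ... | no _     | yes _    = refl
  ... | no _     | no _     = refl

  val-A : ∀ i j → val (A i j) ≡
          (if does (P j ≟ i) then +[1+ toℕ j ] else 0ℤ) ℤ.+
          (if does (Q j ≟ i) then -[1+ toℕ j ] else 0ℤ)
  val-A i j with P j ≟ i | Q j ≟ i
  ... | yes Pj≡i | yes Qj≡i = contradiction (≡.trans Pj≡i (≡.sym Qj≡i)) (P≢Q j)
  ... | yes _    | no _     = ≡.sym (ℤₚ.+-identityʳ _)
  ... | no _     | yes _    = refl
  ... | no _     | no _     = refl

  column-count⁺ : ∀ j → countFin (λ i → isPos (A i j)) ≡ 1
  column-count⁺ j = ≡.trans (countFin-cong (λ i → isPos-A i j)) (countFin-≟ (P j))

  column-count⁻ : ∀ j → countFin (λ i → isNeg (A i j)) ≡ 1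
  column-count⁻ j = ≡.trans (countFin-cong (λ i → isNeg-A i j)) (countFin-≟ (Q j))

  column-filled : ∀ j → countFin (λ i → isFilled (A i j)) ≡ 2
  column-filled j = ≡.trans (countFin-isFilled (λ i → A i j) (λ i → A≢0 i j))
                            (cong₂ _+_ (column-count⁺ j) (column-count⁻ j))

  column-sum : ∀ j → sumFin (λ i → val (A i j)) ≡ 0ℤ
  column-sum j = begin
    sumFin (λ i → val (A i j))
      ≡⟨ sumFin≡sum (λ i → val (A i j)) ⟩
    ℤΣ.sum (λ i → val (A i j))
      ≡⟨ ℤΣ.sum-cong-≗ (λ i → val-A i j) ⟩
    ℤΣ.sum (λ i → positive i ℤ.+ negative i)
      ≡⟨ ℤΣ.∑-distrib-+ positive negative ⟩
    ℤΣ.sum positive ℤ.+ ℤΣ.sum negative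
      ≡⟨ cong₂ ℤ._+_ (ℤΣ.sum-δ′ (P j) _) (ℤΣ.sum-δ′ (Q j) _) ⟩
    v ℤ.+ ℤ.- v
      ≡⟨ ℤₚ.+-inverseʳ v ⟩
    0ℤ
      ∎
    where
    v : ℤ
    v = +[1+ toℕ j ]
    positive negative : Fin m → ℤ
    positive i = if does (P j ≟ i) then v else 0ℤ
    negative i = if does (Q j ≟ i) then ℤ.- v else 0ℤ

  row-count⁺ : ∀ i → countFin (λ j → isPos (A i j)) ≡ ℕΣ.sum (λ j → indicator (does (P j ≟ i)))
  row-count⁺ i = ≡.trans (countFin-cong (isPos-A i)) (countFin≡sum (λ j → does (P j ≟ i)))

  row-count⁻ : ∀ i → countFin (λ j → isNeg (A i j)) ≡ ℕΣ.sum (λ j → indicator (does (Q j ≟ i)))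
  row-count⁻ i = ≡.trans (countFin-cong (isNeg-A i)) (countFin≡sum (λ j → does (Q j ≟ i)))

  row-sum : ∀ i → sumFin (λ j → val (A i j)) ≡
            ℤΣ.sum (λ j → if does (P j ≟ i) then +[1+ toℕ j ] else 0ℤ) ℤ.+
            ℤΣ.sum (λ j → if does (Q j ≟ i) then -[1+ toℕ j ] else 0ℤ)
  row-sum i = ≡.trans (sumFin≡sum (λ j → val (A i j))) (≡.trans (ℤΣ.sum-cong-≗ (val-A i))
    (ℤΣ.∑-distrib-+ (λ j → if does (P j ≟ i) then +[1+ toℕ j ] else 0ℤ)
                    (λ j → if does (Q j ≟ i) then -[1+ toℕ j ] else 0ℤ)))

  entries-bounded : ∀ i j x → A i j ≡ just x → InX n x
  entries-bounded i j x eq with A-just eq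
  ... | inj₁ (_ , refl) = (λ ()) , toℕ<n j
  ... | inj₂ (_ , refl) = (λ ()) , toℕ<n j

  column-of : ∀ {v} (v<n : v ℕ.< n) {j} → toℕ j ≡ v → j ≡ fromℕ< v<n
  column-of v<n j≡v = toℕ-injective (≡.trans j≡v (≡.sym (toℕ-fromℕ< v<n)))

  occurs-once : ∀ x → InX n x →
    Σ (Fin m × Fin n) λ { (i , j) → (A i j ≡ just x) ×
      (∀ i' j' → A i' j' ≡ just x → (i' ≡ i) × (j' ≡ j)) }
  occurs-once (+ zero)  (x≢0 , _)  = contradiction refl x≢0
  occurs-once +[1+ v ] (_ , v<n) =
    (P j , j) , ≡.trans (A-P j) (cong (λ w → just +[1+ w ]) (toℕ-fromℕ< v<n)) , unique
    where
    j : Fin n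
    j = fromℕ< v<n
    unique : ∀ i' j' → A i' j' ≡ just +[1+ v ] → (i' ≡ P j) × (j' ≡ j)
    unique i' j' eq with A-just eq
    ... | inj₁ (Pj'≡i' , v≡j') = ≡.trans (≡.sym Pj'≡i') (cong P j'≡j) , j'≡j
      where
      j'≡j : j' ≡ j
      j'≡j = column-of v<n (≡.sym (ℕₚ.suc-injective (ℤₚ.+-injective v≡j')))
    ... | inj₂ (_ , ())
  occurs-once -[1+ v ] (_ , v<n) =
    (Q j , j) , ≡.trans (A-Q j) (cong (λ w → just -[1+ w ]) (toℕ-fromℕ< v<n)) , unique
    where
    j : Fin n
    j = fromℕ< v<n
    unique : ∀ i' j' → A i' j' ≡ just -[1+ v ] → (i' ≡ Q j) × (j' ≡ j)
    unique i' j' eq with A-just eq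
    ... | inj₁ (_ , ())
    ... | inj₂ (Qj'≡i' , v≡j') = ≡.trans (≡.sym Qj'≡i') (cong Q j'≡j) , j'≡j
      where
      j'≡j : j' ≡ j
      j'≡j = column-of v<n (≡.sym (ℤₚ.-[1+-injective v≡j'))

blockwise-count : ∀ {k m} (σ : Fin k → Permutation′ m) (i : Fin m) →
                  ℕΣ.sum (λ j → indicator (does (blockwise σ j ≟ i))) ≡ k
blockwise-count {k} σ i = ≡.trans (ℕΣ.sum-δ-blockwise σ i (λ _ → 1)) (sum-ones k)

toℕ-combine-⊖ : ∀ {k m} (x : Fin k) (s t : Fin m) →
                +[1+ toℕ (combine x s) ] ℤ.+ -[1+ toℕ (combine x t) ] ≡ toℕ s ⊖ toℕ t
toℕ-combine-⊖ {m = m} x s t = begin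
  suc (toℕ (combine x s)) ⊖ suc (toℕ (combine x t))
    ≡⟨ ℤₚ.[1+m]⊖[1+n]≡m⊖n (toℕ (combine x s)) (toℕ (combine x t)) ⟩
  toℕ (combine x s) ⊖ toℕ (combine x t)
    ≡⟨ cong₂ _⊖_ (toℕ-combine x s) (toℕ-combine x t) ⟩
  (m * toℕ x + toℕ s) ⊖ (m * toℕ x + toℕ t)
    ≡⟨ ℤₚ.+-cancelˡ-⊖ (m * toℕ x) (toℕ s) (toℕ t) ⟩
  toℕ s ⊖ toℕ t
    ∎

module BlockwisePairedColumns {k m} (σ⁺ σ⁻ : Fin k → Permutation′ m)
                              (σ⁺≢σ⁻ : ∀ x y → σ⁺ x ⟨$⟩ʳ y ≢ σ⁻ x ⟨$⟩ʳ y) where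

  open PairedColumns (blockwise σ⁺) (blockwise σ⁻) (λ j → σ⁺≢σ⁻ _ _) public

  row-count⁺-blockwise : ∀ i → countFin (λ j → isPos (A i j)) ≡ k
  row-count⁺-blockwise i = ≡.trans (row-count⁺ i) (blockwise-count σ⁺ i)

  row-count⁻-blockwise : ∀ i → countFin (λ j → isNeg (A i j)) ≡ k
  row-count⁻-blockwise i = ≡.trans (row-count⁻ i) (blockwise-count σ⁻ i)

  row-sum-blockwise : ∀ i → sumFin (λ j → val (A i j)) ≡
                      ℤΣ.sum (λ x → toℕ (σ⁺ x ⟨$⟩ˡ i) ⊖ toℕ (σ⁻ x ⟨$⟩ˡ i))
  row-sum-blockwise i = begin
    sumFin (λ j → val (A i j))
      ≡⟨ row-sum i ⟩
    ℤΣ.sum (λ j → if does (blockwise σ⁺ j ≟ i) then +[1+ toℕ j ] else 0ℤ) ℤ.+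
    ℤΣ.sum (λ j → if does (blockwise σ⁻ j ≟ i) then -[1+ toℕ j ] else 0ℤ)
      ≡⟨ cong₂ ℤ._+_ (ℤΣ.sum-δ-blockwise σ⁺ i _) (ℤΣ.sum-δ-blockwise σ⁻ i _) ⟩
    ℤΣ.sum positive ℤ.+ ℤΣ.sum negative
      ≡⟨ ℤΣ.∑-distrib-+ positive negative ⟨
    ℤΣ.sum (λ x → positive x ℤ.+ negative x)
      ≡⟨ ℤΣ.sum-cong-≗ (λ x → toℕ-combine-⊖ x (σ⁺ x ⟨$⟩ˡ i) (σ⁻ x ⟨$⟩ˡ i)) ⟩
    ℤΣ.sum (λ x → toℕ (σ⁺ x ⟨$⟩ˡ i) ⊖ toℕ (σ⁻ x ⟨$⟩ˡ i))
      ∎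
    where
    positive negative : Fin k → ℤ
    positive x = +[1+ toℕ (combine x (σ⁺ x ⟨$⟩ˡ i)) ]
    negative x = -[1+ toℕ (combine x (σ⁻ x ⟨$⟩ˡ i)) ]

positiveRow negativeRow : ∀ {n} → Fin 2 → Permutation′ (suc n)
positiveRow 0F = id
positiveRow 1F = rotation
negativeRow 0F = rotation
negativeRow 1F = id

positiveRow≢negativeRow : ∀ {n} h (y : Fin (suc (suc n))) →
                          positiveRow h ⟨$⟩ʳ y ≢ negativeRow h ⟨$⟩ʳ y
positiveRow≢negativeRow 0F y = rotation-≢ y ∘ ≡.sym
positiveRow≢negativeRow 1F y = rotation-≢ y

orientations-cancel : ∀ {n} (i : Fin (suc n)) →
  ℤΣ.sum (λ h → toℕ (positiveRow h ⟨$⟩ˡ i) ⊖ toℕ (negativeRow h ⟨$⟩ˡ i)) ≡ 0ℤ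
orientations-cancel i = begin
  (s ⊖ t) ℤ.+ ((t ⊖ s) ℤ.+ 0ℤ) ≡⟨ cong (λ z → (s ⊖ t) ℤ.+ z) (ℤₚ.+-identityʳ (t ⊖ s)) ⟩
  (s ⊖ t) ℤ.+ (t ⊖ s)          ≡⟨ cong (λ z → (s ⊖ t) ℤ.+ z) (ℤₚ.⊖-swap t s) ⟩
  (s ⊖ t) ℤ.+ ℤ.- (s ⊖ t)      ≡⟨ ℤₚ.+-inverseʳ (s ⊖ t) ⟩
  0ℤ                           ∎
  where
  s t : ℕ
  s = toℕ i
  t = toℕ (rotation ⟨$⟩ˡ i)

half-size : ∀ a m → (m * (4 * a)) / 2 ≡ 2 * a * m
half-size a m = ≡.trans (cong (_/ 2) (reorder a m)) (m*n/n≡m (2 * a * m) 2)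
  where
  reorder : ∀ a m → m * (4 * a) ≡ 2 * a * m * 2
  reorder = solve-∀

shiftableSMR : ∀ a m → 2 ≤ m →
  Σ (Array m (2 * a * m)) λ A → IsSMR m (2 * a * m) (4 * a) 2 A × Shiftable A
shiftableSMR a (suc zero)    (s≤s ())
shiftableSMR a (suc (suc k)) _ = A , isSMR , shiftable
  where
  σ⁺ σ⁻ : Fin (2 * a) → Permutation′ (suc (suc k))
  σ⁺ x = positiveRow (quotient a x)
  σ⁻ x = negativeRow (quotient a x)

  open BlockwisePairedColumns σ⁺ σ⁻ (positiveRow≢negativeRow ∘ quotient a)

  row-cancels : ∀ i → ℤΣ.sum (λ x → toℕ (σ⁺ x ⟨$⟩ˡ i) ⊖ toℕ (σ⁻ x ⟨$⟩ˡ i)) ≡ 0ℤ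
  row-cancels i = begin
    ℤΣ.sum (λ x → toℕ (σ⁺ x ⟨$⟩ˡ i) ⊖ toℕ (σ⁻ x ⟨$⟩ˡ i))
      ≡⟨ ℤΣ.sum-quotient 2 a d ⟩
    ℤΣ.sum {a} (λ _ → ℤΣ.sum d)
      ≡⟨ ℤΣ.sum-cong-≗ {a} (λ _ → orientations-cancel i) ⟩
    ℤΣ.sum {a} (λ _ → 0ℤ)
      ≡⟨ ℤΣ.sum-replicate-zero a ⟩
    0ℤ
      ∎
    where
    d : Fin 2 → ℤ
    d h = toℕ (positiveRow h ⟨$⟩ˡ i) ⊖ toℕ (negativeRow h ⟨$⟩ˡ i)

  isSMR : IsSMR (suc (suc k)) (2 * a * suc (suc k)) (4 * a) 2 A
  isSMR = record
    { rowFilled  = λ i → ≡.trans (countFin-isFilled (A i) (A≢0 i))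
                          (≡.trans (cong₂ _+_ (row-count⁺-blockwise i) (row-count⁻-blockwise i))
                                   (≡.sym (ℕₚ.*-distribʳ-+ a 2 2)))
    ; colFilled  = column-filled
    ; entriesInX = λ i j x eq → subst (λ N → InX N x) (≡.sym (half-size a _)) (entries-bounded i j x eq)
    ; eachOnce   = λ x x∈X → occurs-once x (subst (λ N → InX N x) (half-size a _) x∈X)
    ; rowSum     = λ i → ≡.trans (row-sum-blockwise i) (row-cancels i)
    ; colSum     = column-sum
    }

  shiftable : Shiftable A
  shiftable = (λ i → ≡.trans (row-count⁺-blockwise i) (≡.sym (row-count⁻-blockwise i)))
            , (λ j → ≡.trans (column-count⁺ j) (≡.sym (column-count⁻ j)))

lemma22 : ∀ (a b : ℕ) → a ≥ 1 → b ≥ 1 →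
    Σ (Array (4 * b + 1) (2 * a * (4 * b + 1))) λ A →
      IsSMR (4 * b + 1) (2 * a * (4 * b + 1)) (4 * a) 2 A × Shiftable A
lemma22 a b _ b≥1 = shiftableSMR a (4 * b + 1)
  (ℕₚ.≤-trans (s≤s (s≤s z≤n)) (ℕₚ.+-monoˡ-≤ 1 (ℕₚ.*-monoʳ-≤ 4 b≥1)))
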